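{- Let $(a_n)_{n\geq 0}$ be a sequence of integers such that for every integer $n\geq 0$ and every prime $p$ we have $a_{n+p}\equiv a_n\pmod p$, and let $f(x)=\sum_{n\geq 0}a_nx^n$. Then for every positive integer $n$, the integer $\det H_n(f)$ is divisible by $$\prod_{\substack{p\leq n-1\\ p\text{ prime}}}p^{\,n-p}.$$
   Context: For a positive integer $n$, $H_n(f)$ is the $n\times n$ Hankel matrix $(a_{i+j-2})_{1\leq i,j\leq n}$ of $f$. -}

module Defs where

open import Data.Nat as ℕ using (ℕ; zero; suc)
open import Data.Nat.Primality using (prime?)
open import Data.Integer as ℤ using (ℤ; +_)
open import Data.Fin using (Fin; zero; suc; toℕ; punchIn)
open import Relation.Nullary.Decidable using (does)
open import Data.Bool using (if_then_else_)

Matrix : ℕ → Set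
Matrix n = Fin n → Fin n → ℤ

Σℤ : (n : ℕ) → (Fin n → ℤ) → ℤ
Σℤ zero    f = + 0
Σℤ (suc n) f = f zero ℤ.+ Σℤ n (λ i → f (suc i))

sign : ℕ → ℤ
sign zero    = + 1
sign (suc k) = ℤ.- sign k

minor : ∀ {n} → Matrix (suc n) → Fin (suc n) → Matrix n
minor M j r c = M (suc r) (punchIn j c)

det : (n : ℕ) → Matrix n → ℤ
det zero    M = + 1
det (suc n) M = Σℤ (suc n) (λ j → sign (toℕ j) ℤ.* (M zero j ℤ.* det n (minor M j)))

-- Hankel matrix H_n(f) = (a_{i+j-2})_{1≤i,j≤n}, i.e. 0-indexed (a_{i+j})
hankel : (ℕ → ℤ) → (n : ℕ) → Matrix n
hankel a n i j = a (toℕ i ℕ.+ toℕ j)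

primeProd : (m n : ℕ) → ℕ
primeProd zero    n = 1
primeProd (suc m) n =
  (if does (prime? (suc m)) then suc m ℕ.^ (n ℕ.∸ suc m) else 1) ℕ.* primeProd m n

{-# OPTIONS --safe #-}
-- For a prime p and a row index r ≥ p, row r of Hₙ(f) is congruent mod p to row r − p, because
-- a_{r+c} ≡ a_{r−p+c}. Starting from the last row, write row r as (row r − p) + p·q; since the
-- determinant is multilinear and alternating in the rows, det = p · det(row r replaced by q), and the
-- rows before r are untouched, so the argument repeats for each of the n − p rows with index ≥ p,
-- giving p^(n−p) ∣ det Hₙ(f). These prime powers are pairwise coprime, so their product divides too.
--
-- The determinant is given by Laplace expansion along the first row, so the alternating property
-- has to be proved: expanding along the first two rows shows that swapping them negates det.
module Submission where

open import Data.Fin using (Fin; zero; suc; toℕ; punchIn; fromℕ<)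
open import Data.Fin.Properties using (toℕ-fromℕ<; suc-injective)
open import Data.Product using (∃-syntax; _×_; _,_)
open import Data.Sum using (inj₁; inj₂; [_,_]′)
open import Function using (_∘_; const)
open import Relation.Binary.PropositionalEquality
open import Relation.Nullary using (yes; no; contradiction)
open import Defs

module Determinant where
  open import Data.Nat using (ℕ; zero; suc; _∸_; _^_; _≤_; _<_; _≤?_)
  import Data.Nat.Properties as ℕ
  open import Data.Integer using (ℤ; +_; -[1+_]; _+_; _-_; _*_; -_)
  open import Data.Integer.Properties
    using (+-*-semiring; +-identityˡ; *-identityˡ; *-identityʳ; *-zeroʳ; *-comm; *-distribˡ-+;
           neg-distrib-+; neg-involutive; pos-*)
  open import Data.Integer.Divisibility.Signed using (_∣_; divides; quotient; *-monoʳ-∣)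
  open import Data.Integer.Tactic.RingSolver using (solve-∀)
  open import Algebra.Properties.Semiring.Sum +-*-semiring using (sum; ∑-distrib-+; ∑-comm; sum-remove)
  open import Data.Vec.Functional using (updateAt)
  open import Data.Vec.Functional.Properties using (updateAt-updates; updateAt-minimal)
  open import Data.Empty using (⊥-elim)
  open ≡-Reasoning

  1∣_ : ∀ x → + 1 ∣ x
  1∣ x = divides x (sym (*-identityʳ x))

  Σℤ≡sum : ∀ n (f : Fin n → ℤ) → Σℤ n f ≡ sum f
  Σℤ≡sum zero    f = refl
  Σℤ≡sum (suc n) f = cong (_+_ (f zero)) (Σℤ≡sum n (f ∘ suc))

  Σℤ-cong : ∀ n {f g : Fin n → ℤ} → f ≗ g → Σℤ n f ≡ Σℤ n g
  Σℤ-cong zero    f≗g = refl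
  Σℤ-cong (suc n) f≗g = cong₂ _+_ (f≗g zero) (Σℤ-cong n (f≗g ∘ suc))

  Σℤ-zero : ∀ n {f : Fin n → ℤ} → (∀ i → f i ≡ + 0) → Σℤ n f ≡ + 0
  Σℤ-zero zero    f≡0 = refl
  Σℤ-zero (suc n) f≡0 = cong₂ _+_ (f≡0 zero) (Σℤ-zero n (f≡0 ∘ suc))

  *-distribˡ-Σℤ : ∀ c n (f : Fin n → ℤ) → c * Σℤ n f ≡ Σℤ n (λ i → c * f i)
  *-distribˡ-Σℤ c zero    f = *-zeroʳ c
  *-distribˡ-Σℤ c (suc n) f =
    trans (*-distribˡ-+ c (f zero) _) (cong (_+_ (c * f zero)) (*-distribˡ-Σℤ c n (f ∘ suc)))

  neg-distrib-Σℤ : ∀ n (f : Fin n → ℤ) → - Σℤ n f ≡ Σℤ n (-_ ∘ f)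
  neg-distrib-Σℤ zero    f = refl
  neg-distrib-Σℤ (suc n) f =
    trans (neg-distrib-+ (f zero) _) (cong (_+_ (- f zero)) (neg-distrib-Σℤ n (f ∘ suc)))

  Σℤ-distrib-+ : ∀ n (f g : Fin n → ℤ) → Σℤ n (λ i → f i + g i) ≡ Σℤ n f + Σℤ n g
  Σℤ-distrib-+ n f g = begin
    Σℤ n (λ i → f i + g i) ≡⟨ Σℤ≡sum n _ ⟩
    sum (λ i → f i + g i)  ≡⟨ ∑-distrib-+ f g ⟩
    sum f + sum g          ≡⟨ cong₂ _+_ (Σℤ≡sum n f) (Σℤ≡sum n g) ⟨
    Σℤ n f + Σℤ n g        ∎

  Σℤ-comm : ∀ m n (f : Fin m → Fin n → ℤ) →
            Σℤ m (λ i → Σℤ n (f i)) ≡ Σℤ n (λ j → Σℤ m (λ i → f i j))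
  Σℤ-comm m n f = begin
    Σℤ m (λ i → Σℤ n (f i))          ≡⟨ Σℤ-cong m (λ i → Σℤ≡sum n (f i)) ⟩
    Σℤ m (λ i → sum (f i))           ≡⟨ Σℤ≡sum m _ ⟩
    sum (λ i → sum (f i))            ≡⟨ ∑-comm f ⟩
    sum (λ j → sum (λ i → f i j))    ≡⟨ Σℤ≡sum n _ ⟨
    Σℤ n (λ j → sum (λ i → f i j))   ≡⟨ Σℤ-cong n (λ j → Σℤ≡sum m (λ i → f i j)) ⟨
    Σℤ n (λ j → Σℤ m (λ i → f i j))  ∎

  Σℤ-remove : ∀ n (f : Fin (suc n) → ℤ) i → Σℤ (suc n) f ≡ f i + Σℤ n (f ∘ punchIn i)
  Σℤ-remove n f i = begin
    Σℤ (suc n) f                ≡⟨ Σℤ≡sum (suc n) f ⟩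
    sum f                       ≡⟨ sum-remove f ⟩
    f i + sum (f ∘ punchIn i)   ≡⟨ cong (_+_ (f i)) (Σℤ≡sum n (f ∘ punchIn i)) ⟨
    f i + Σℤ n (f ∘ punchIn i)  ∎

  Σℤ-linear : ∀ n c (f g h : Fin n → ℤ) → (∀ i → f i ≡ g i + c * h i) →
              Σℤ n f ≡ Σℤ n g + c * Σℤ n h
  Σℤ-linear n c f g h f≡g+ch = begin
    Σℤ n f                          ≡⟨ Σℤ-cong n f≡g+ch ⟩
    Σℤ n (λ i → g i + c * h i)      ≡⟨ Σℤ-distrib-+ n g (λ i → c * h i) ⟩
    Σℤ n g + Σℤ n (λ i → c * h i)   ≡⟨ cong (_+_ (Σℤ n g)) (*-distribˡ-Σℤ c n h) ⟨
    Σℤ n g + c * Σℤ n h             ∎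

  laplaceTerm : ∀ {n} → Matrix (suc n) → Fin (suc n) → ℤ
  laplaceTerm {n} M j = sign (toℕ j) * (M zero j * det n (minor M j))

  det-cong : ∀ n {M N : Matrix n} → (∀ i j → M i j ≡ N i j) → det n M ≡ det n N
  det-cong zero    M≈N = refl
  det-cong (suc n) M≈N = Σℤ-cong (suc n) λ j →
    cong₂ (λ x d → sign (toℕ j) * (x * d))
          (M≈N zero j) (det-cong n (λ r c → M≈N (suc r) (punchIn j c)))

  det-linear : ∀ n (r : Fin n) c {M A B : Matrix n} →
               (∀ i → i ≢ r → A i ≗ M i) → (∀ i → i ≢ r → B i ≗ M i) →
               (∀ j → M r j ≡ A r j + c * B r j) →
               det n M ≡ det n A + c * det n B
  det-linear (suc n) zero c {M} {A} {B} A≈M B≈M M₀≡A₀+cB₀ =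
    Σℤ-linear (suc n) c (laplaceTerm M) (laplaceTerm A) (laplaceTerm B) term
    where
    distrib : ∀ s x c y d → s * ((x + c * y) * d) ≡ s * (x * d) + c * (s * (y * d))
    distrib = solve-∀

    term : ∀ j → laplaceTerm M j ≡ laplaceTerm A j + c * laplaceTerm B j
    term j = begin
      s * (M zero j * det n (minor M j))
        ≡⟨ cong₂ (λ x d → s * (x * d)) (M₀≡A₀+cB₀ j) (det-cong n minorM≈minorA) ⟩
      s * ((A zero j + c * B zero j) * D)
        ≡⟨ distrib s (A zero j) c (B zero j) D ⟩
      s * (A zero j * D) + c * (s * (B zero j * D))
        ≡⟨ cong (λ d → s * (A zero j * D) + c * (s * (B zero j * d))) (det-cong n minorA≈minorB) ⟩
      laplaceTerm A j + c * laplaceTerm B j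
        ∎
      where
      s = sign (toℕ j)
      D = det n (minor A j)
      minorM≈minorA : ∀ i k → minor M j i k ≡ minor A j i k
      minorM≈minorA i k = sym (A≈M (suc i) (λ ()) (punchIn j k))
      minorA≈minorB : ∀ i k → minor A j i k ≡ minor B j i k
      minorA≈minorB i k = trans (A≈M (suc i) (λ ()) (punchIn j k)) (sym (B≈M (suc i) (λ ()) (punchIn j k)))
  det-linear (suc n) (suc r) c {M} {A} {B} A≈M B≈M Mr≡Ar+cBr =
    Σℤ-linear (suc n) c (laplaceTerm M) (laplaceTerm A) (laplaceTerm B) term
    where
    distrib : ∀ s x d c e → s * (x * (d + c * e)) ≡ s * (x * d) + c * (s * (x * e))
    distrib = solve-∀

    term : ∀ j → laplaceTerm M j ≡ laplaceTerm A j + c * laplaceTerm B j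
    term j = begin
      s * (M zero j * det n (minor M j))
        ≡⟨ cong (λ d → s * (M zero j * d)) minor-linear ⟩
      s * (M zero j * (det n (minor A j) + c * det n (minor B j)))
        ≡⟨ distrib s (M zero j) _ c _ ⟩
      s * (M zero j * det n (minor A j)) + c * (s * (M zero j * det n (minor B j)))
        ≡⟨ cong₂ (λ x y → s * (x * det n (minor A j)) + c * (s * (y * det n (minor B j))))
                 (sym (A≈M zero (λ ()) j)) (sym (B≈M zero (λ ()) j)) ⟩
      laplaceTerm A j + c * laplaceTerm B j
        ∎
      where
      s = sign (toℕ j)
      minor-linear : det n (minor M j) ≡ det n (minor A j) + c * det n (minor B j)
      minor-linear = det-linear n r c (λ i i≢r k → A≈M (suc i) (i≢r ∘ suc-injective) (punchIn j k))
                                      (λ i i≢r k → B≈M (suc i) (i≢r ∘ suc-injective) (punchIn j k))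
                                      (Mr≡Ar+cBr ∘ punchIn j)

  -- The sign of M₀ₐ M₁ᵦ in the expansion of det along its first two rows. It vanishes on the diagonal,
  -- so that expansion may run over all pairs (a, b) and swapping the two rows becomes a reindexing.
  pairSign : ∀ {m} → Fin m → Fin m → ℤ
  pairSign zero    zero    = + 0
  pairSign zero    (suc b) = sign (toℕ b)
  pairSign (suc a) zero    = - sign (toℕ a)
  pairSign (suc a) (suc b) = pairSign a b

  pairSign-diag : ∀ {m} (a : Fin m) → pairSign a a ≡ + 0
  pairSign-diag zero    = refl
  pairSign-diag (suc a) = pairSign-diag a

  pairSign-antisym : ∀ {m} (a b : Fin m) → pairSign b a ≡ - pairSign a b
  pairSign-antisym zero    zero    = refl
  pairSign-antisym zero    (suc b) = refl
  pairSign-antisym (suc a) zero    = sym (neg-involutive (sign (toℕ a)))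
  pairSign-antisym (suc a) (suc b) = pairSign-antisym a b

  pairSign-punchIn : ∀ {m} (a : Fin (suc m)) k → pairSign a (punchIn a k) ≡ sign (toℕ a) * sign (toℕ k)
  pairSign-punchIn zero    k       = sym (*-identityˡ (sign (toℕ k)))
  pairSign-punchIn (suc a) zero    = sym (*-identityʳ (- sign (toℕ a)))
  pairSign-punchIn (suc a) (suc k) = trans (pairSign-punchIn a k) (neg-*-neg (sign (toℕ a)) (sign (toℕ k)))
    where
    neg-*-neg : ∀ x y → x * y ≡ - x * - y
    neg-*-neg = solve-∀

  -- For a ≢ b, punchIn₂ a b enumerates the complement of {a, b} in increasing order.
  punchIn₂ : ∀ {n} → Fin (suc (suc n)) → Fin (suc (suc n)) → Fin n → Fin (suc (suc n))
  punchIn₂         zero    zero    c       = suc (suc c)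
  punchIn₂         zero    (suc b) c       = suc (punchIn b c)
  punchIn₂         (suc a) zero    c       = suc (punchIn a c)
  punchIn₂ {suc n} (suc a) (suc b) zero    = zero
  punchIn₂ {suc n} (suc a) (suc b) (suc c) = suc (punchIn₂ a b c)

  punchIn₂-sym : ∀ {n} a b (c : Fin n) → punchIn₂ a b c ≡ punchIn₂ b a c
  punchIn₂-sym         zero    zero    c       = refl
  punchIn₂-sym         zero    (suc b) c       = refl
  punchIn₂-sym         (suc a) zero    c       = refl
  punchIn₂-sym {suc n} (suc a) (suc b) zero    = refl
  punchIn₂-sym {suc n} (suc a) (suc b) (suc c) = cong suc (punchIn₂-sym a b c)

  punchIn-punchIn : ∀ {n} a (k : Fin (suc n)) c → punchIn a (punchIn k c) ≡ punchIn₂ a (punchIn a k) c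
  punchIn-punchIn         zero    k       c       = refl
  punchIn-punchIn         (suc a) zero    c       = refl
  punchIn-punchIn {suc n} (suc a) (suc k) zero    = refl
  punchIn-punchIn {suc n} (suc a) (suc k) (suc c) = cong suc (punchIn-punchIn a k c)

  pairTerm : ∀ {n} → Matrix (suc (suc n)) → Fin (suc (suc n)) → Fin (suc (suc n)) → ℤ
  pairTerm {n} M a b =
    pairSign a b * (M zero a * (M (suc zero) b * det n (λ r c → M (suc (suc r)) (punchIn₂ a b c))))

  det-pairExpansion : ∀ n (M : Matrix (suc (suc n))) →
                      det (suc (suc n)) M ≡ Σℤ (suc (suc n)) (λ a → Σℤ (suc (suc n)) (pairTerm M a))
  det-pairExpansion n M = Σℤ-cong (suc (suc n)) expand
    where
    reassoc : ∀ s x t y d → s * (x * (t * (y * d))) ≡ (s * t) * (x * (y * d))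
    reassoc = solve-∀

    term : ∀ a k → sign (toℕ a) * (M zero a * laplaceTerm (minor M a) k) ≡ pairTerm M a (punchIn a k)
    term a k =
      trans (reassoc (sign (toℕ a)) (M zero a) (sign (toℕ k)) (M (suc zero) (punchIn a k))
                     (det n (minor (minor M a) k)))
            (cong₂ (λ s d → s * (M zero a * (M (suc zero) (punchIn a k) * d)))
                   (sym (pairSign-punchIn a k))
                   (det-cong n (λ r c → cong (M (suc (suc r))) (punchIn-punchIn a k c))))

    pairTerm-diag : ∀ a → pairTerm M a a ≡ + 0
    pairTerm-diag a =
      cong (_* (M zero a * (M (suc zero) a * det n (λ r c → M (suc (suc r)) (punchIn₂ a a c)))))
           (pairSign-diag a)

    expand : ∀ a → laplaceTerm M a ≡ Σℤ (suc (suc n)) (pairTerm M a)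
    expand a = begin
      sign (toℕ a) * (M zero a * Σℤ (suc n) (laplaceTerm (minor M a)))
        ≡⟨ cong (sign (toℕ a) *_) (*-distribˡ-Σℤ (M zero a) (suc n) (laplaceTerm (minor M a))) ⟩
      sign (toℕ a) * Σℤ (suc n) (λ k → M zero a * laplaceTerm (minor M a) k)
        ≡⟨ *-distribˡ-Σℤ (sign (toℕ a)) (suc n) (λ k → M zero a * laplaceTerm (minor M a) k) ⟩
      Σℤ (suc n) (λ k → sign (toℕ a) * (M zero a * laplaceTerm (minor M a) k))
        ≡⟨ Σℤ-cong (suc n) (term a) ⟩
      Σℤ (suc n) (pairTerm M a ∘ punchIn a)
        ≡⟨ +-identityˡ _ ⟨
      + 0 + Σℤ (suc n) (pairTerm M a ∘ punchIn a)
        ≡⟨ cong (_+ Σℤ (suc n) (pairTerm M a ∘ punchIn a)) (pairTerm-diag a) ⟨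
      pairTerm M a a + Σℤ (suc n) (pairTerm M a ∘ punchIn a)
        ≡⟨ Σℤ-remove (suc n) (pairTerm M a) a ⟨
      Σℤ (suc (suc n)) (pairTerm M a)
        ∎

  swap01 : ∀ {n} → Matrix (suc (suc n)) → Matrix (suc (suc n))
  swap01 M zero          = M (suc zero)
  swap01 M (suc zero)    = M zero
  swap01 M (suc (suc r)) = M (suc (suc r))

  pairTerm-swap01 : ∀ {n} (M : Matrix (suc (suc n))) a b → pairTerm (swap01 M) a b ≡ - pairTerm M b a
  pairTerm-swap01 {n} M a b = begin
    pairSign a b * (M (suc zero) a * (M zero b * D a b))
      ≡⟨ cong₂ (λ s d → s * (M (suc zero) a * (M zero b * d)))
               (pairSign-antisym b a) (det-cong n (λ r c → cong (M (suc (suc r))) (punchIn₂-sym a b c))) ⟩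
    - pairSign b a * (M (suc zero) a * (M zero b * D b a))
      ≡⟨ neg-swap (pairSign b a) (M (suc zero) a) (M zero b) (D b a) ⟩
    - (pairSign b a * (M zero b * (M (suc zero) a * D b a)))
      ∎
    where
    D : Fin (suc (suc n)) → Fin (suc (suc n)) → ℤ
    D a b = det n (λ r c → M (suc (suc r)) (punchIn₂ a b c))
    neg-swap : ∀ s x y d → - s * (x * (y * d)) ≡ - (s * (y * (x * d)))
    neg-swap = solve-∀

  det-swap01 : ∀ n (M : Matrix (suc (suc n))) → det (suc (suc n)) (swap01 M) ≡ - det (suc (suc n)) M
  det-swap01 n M = begin
    det N (swap01 M)                           ≡⟨ det-pairExpansion n (swap01 M) ⟩
    Σℤ N (λ a → Σℤ N (pairTerm (swap01 M) a))
      ≡⟨ Σℤ-cong N (λ a → Σℤ-cong N (pairTerm-swap01 M a)) ⟩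
    Σℤ N (λ a → Σℤ N (λ b → - pairTerm M b a))
      ≡⟨ Σℤ-comm N N (λ a b → - pairTerm M b a) ⟩
    Σℤ N (λ b → Σℤ N (λ a → - pairTerm M b a))
      ≡⟨ Σℤ-cong N (λ b → neg-distrib-Σℤ N (pairTerm M b)) ⟨
    Σℤ N (λ b → - Σℤ N (pairTerm M b))
      ≡⟨ neg-distrib-Σℤ N (λ b → Σℤ N (pairTerm M b)) ⟨
    - Σℤ N (λ b → Σℤ N (pairTerm M b))
      ≡⟨ cong -_ (det-pairExpansion n M) ⟨
    - det N M
      ∎
    where
    N = suc (suc n)

  Alternating : ℕ → Set
  Alternating n = ∀ (M : Matrix n) {i j} → i ≢ j → M i ≗ M j → det n M ≡ + 0

  det-equalLowerRows : ∀ {n} → Alternating n →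
                       ∀ (M : Matrix (suc n)) {i j} → i ≢ j → M (suc i) ≗ M (suc j) → det (suc n) M ≡ + 0
  det-equalLowerRows {n} alt M i≢j Mi≗Mj = Σℤ-zero (suc n) λ a →
    trans (cong (λ d → sign (toℕ a) * (M zero a * d)) (alt (minor M a) i≢j (Mi≗Mj ∘ punchIn a)))
          (trans (cong (sign (toℕ a) *_) (*-zeroʳ (M zero a))) (*-zeroʳ (sign (toℕ a))))

  det-equalFirstRow : ∀ {n} → Alternating n →
                      ∀ (M : Matrix (suc n)) j → M zero ≗ M (suc j) → det (suc n) M ≡ + 0
  det-equalFirstRow {suc n} alt M zero M₀≗M₁ =
    self-neg⇒zero (trans (det-cong (suc (suc n)) M≈swap01M) (det-swap01 n M))
    where
    M≈swap01M : ∀ r c → M r c ≡ swap01 M r c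
    M≈swap01M zero            = M₀≗M₁
    M≈swap01M (suc zero)      = sym ∘ M₀≗M₁
    M≈swap01M (suc (suc r)) c = refl

    self-neg⇒zero : ∀ {x} → x ≡ - x → x ≡ + 0
    self-neg⇒zero {+ zero}     _  = refl
    self-neg⇒zero {+ suc _}    ()
    self-neg⇒zero { -[1+ _ ] } ()
  det-equalFirstRow {suc n} alt M (suc j) M₀≗Mⱼ = begin
    det (suc (suc n)) M             ≡⟨ neg-involutive _ ⟨
    - - det (suc (suc n)) M         ≡⟨ cong -_ (det-swap01 n M) ⟨
    - det (suc (suc n)) (swap01 M)  ≡⟨ cong -_ (det-equalLowerRows alt (swap01 M) {zero} {suc j} (λ ()) M₀≗Mⱼ) ⟩
    + 0                             ∎

  det-alternating : ∀ n → Alternating n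
  det-alternating (suc n) M {zero}  {zero}  i≢j _     = ⊥-elim (i≢j refl)
  det-alternating (suc n) M {suc i} {suc j} i≢j Mi≗Mj =
    det-equalLowerRows (det-alternating n) M (i≢j ∘ cong suc) Mi≗Mj
  det-alternating (suc n) M {zero}  {suc j} _   M₀≗Mj =
    det-equalFirstRow (det-alternating n) M j M₀≗Mj
  det-alternating (suc n) M {suc i} {zero}  _   Mi≗M₀ =
    det-equalFirstRow (det-alternating n) M i (sym ∘ Mi≗M₀)

  det-subtractRow : ∀ n (M : Matrix n) {r g} d (q : Fin n → ℤ) → g ≢ r →
                    (∀ c → M r c ≡ M g c + d * q c) → det n M ≡ d * det n (updateAt M r (const q))
  det-subtractRow n M {r} {g} d q g≢r Mr≡Mg+dq = begin
    det n M                ≡⟨ det-linear n r d unchanged unchanged Mr≡Ar+dBr ⟩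
    det n A + d * det n B  ≡⟨ cong (_+ d * det n B) (det-alternating n A g≢r Ag≗Ar) ⟩
    + 0 + d * det n B      ≡⟨ +-identityˡ _ ⟩
    d * det n B            ∎
    where
    A B : Matrix n
    A = updateAt M r (const (M g))
    B = updateAt M r (const q)
    unchanged : ∀ {f} i → i ≢ r → updateAt M r f i ≗ M i
    unchanged i i≢r = cong-app (updateAt-minimal i r M i≢r)
    Mr≡Ar+dBr : ∀ c → M r c ≡ A r c + d * B r c
    Mr≡Ar+dBr c = trans (Mr≡Mg+dq c)
                        (sym (cong₂ (λ x y → x c + d * y c) (updateAt-updates r M) (updateAt-updates r M)))
    Ag≗Ar : A g ≗ A r
    Ag≗Ar = cong-app (trans (updateAt-minimal g r M g≢r) (sym (updateAt-updates r M)))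

  ReducibleRows : ∀ {n} → ℕ → ℕ → ℕ → Matrix n → Set
  ReducibleRows {n} d s m M =
    ∀ (r : Fin n) → s ≤ toℕ r → toℕ r < m → ∃[ g ] toℕ g < toℕ r × (∀ c → + d ∣ M r c - M g c)

  reducibleRows-updateAt : ∀ {n d s} {M : Matrix n} r f →
                           ReducibleRows d s (suc (toℕ r)) M → ReducibleRows d s (toℕ r) (updateAt M r f)
  reducibleRows-updateAt {d = d} {M = M} r f red i s≤i i<r with red i s≤i (ℕ.m<n⇒m<1+n i<r)
  ... | g , g<i , d∣Mi-Mg = g , g<i , λ c →
    subst (+ d ∣_) (sym (cong₂ _-_ (unchanged i i<r c) (unchanged g (ℕ.<-trans g<i i<r) c))) (d∣Mi-Mg c)
    where
    unchanged : ∀ k → toℕ k < toℕ r → updateAt M r f k ≗ M k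
    unchanged k k<r = cong-app (updateAt-minimal k r M (λ k≡r → ℕ.<-irrefl (cong toℕ k≡r) k<r))

  det-reduceRow : ∀ {n d s m} {M : Matrix n} (r : Fin n) → toℕ r ≡ m → s ≤ m →
                  ReducibleRows d s (suc m) M → ∃[ B ] det n M ≡ + d * det n B × ReducibleRows d s m B
  det-reduceRow {n} {d} {M = M} r refl s≤r red with red r s≤r ℕ.≤-refl
  ... | g , g<r , d∣Mr-Mg =
    updateAt M r (const q) ,
    det-subtractRow n M (+ d) q (λ g≡r → ℕ.<-irrefl (cong toℕ g≡r) g<r) Mr≡Mg+dq ,
    reducibleRows-updateAt r (const q) red
    where
    q : Fin n → ℤ
    q c = quotient (d∣Mr-Mg c)
    x≡y+[x-y] : ∀ x y → x ≡ y + (x - y)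
    x≡y+[x-y] = solve-∀
    Mr≡Mg+dq : ∀ c → M r c ≡ M g c + + d * q c
    Mr≡Mg+dq c = trans (x≡y+[x-y] (M r c) (M g c))
                       (cong (_+_ (M g c)) (trans (_∣_.equality (d∣Mr-Mg c)) (*-comm (q c) (+ d))))

  reducibleRows⇒∣det : ∀ {n} d s m (M : Matrix n) → m ≤ n → ReducibleRows d s m M →
                       + (d ^ (m ∸ s)) ∣ det n M
  reducibleRows⇒∣det d s zero M _ _ rewrite ℕ.0∸n≡0 s = 1∣ _
  reducibleRows⇒∣det {n} d s (suc m) M m<n red with s ≤? m
  ... | no  s≰m rewrite ℕ.m≤n⇒m∸n≡0 (ℕ.≰⇒> s≰m) = 1∣ _
  ... | yes s≤m rewrite ℕ.+-∸-assoc 1 s≤m with det-reduceRow (fromℕ< m<n) (toℕ-fromℕ< m<n) s≤m red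
  ... | B , detM≡d*detB , redB = subst₂ _∣_ (sym (pos-* d (d ^ (m ∸ s)))) (sym detM≡d*detB)
                                   (*-monoʳ-∣ (+ d) (reducibleRows⇒∣det d s m B (ℕ.<⇒≤ m<n) redB))

module PrimeProduct where
  open import Data.Nat using (zero; suc; _*_; _^_; _∸_; _<_)
  open import Data.Nat.Properties using (*-identityˡ; *-comm; *-commutativeSemigroup; ≤-refl; <-trans; n<1+n)
  open import Algebra.Properties.CommutativeSemigroup *-commutativeSemigroup using (xy∙z≈y∙xz)
  open import Data.Nat.Divisibility
    using (_∣_; _∤_; divides; 1∣_; ∣1⇒≡1; *-monoʳ-∣; *-monoˡ-∣; *-cancelˡ-∣; m*n∣⇒m∣; >⇒∤)
  open import Data.Nat.Primality using (Prime; prime?; euclidsLemma; prime⇒nonZero; ¬prime[1])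

  prime∤1 : ∀ {p} → Prime p → p ∤ 1
  prime∤1 p-prime p∣1 = ¬prime[1] (subst Prime (∣1⇒≡1 p∣1) p-prime)

  prime∤^ : ∀ {p b} → Prime p → p ∤ b → ∀ e → p ∤ b ^ e
  prime∤^ p-prime p∤b zero    = prime∤1 p-prime
  prime∤^ p-prime p∤b (suc e) = [ p∤b , prime∤^ p-prime p∤b e ]′ ∘ euclidsLemma _ _ p-prime

  prime∤primeProd : ∀ {p} N m → Prime p → m < p → p ∤ primeProd m N
  prime∤primeProd N zero    p-prime _   = prime∤1 p-prime
  prime∤primeProd N (suc m) p-prime m<p with prime? (suc m)
  ... | yes _ = [ prime∤^ p-prime (>⇒∤ m<p) (N ∸ suc m) , p∤rest ]′ ∘ euclidsLemma _ _ p-prime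
    where p∤rest = prime∤primeProd N m p-prime (<-trans (n<1+n m) m<p)
  ... | no  _ = prime∤primeProd N m p-prime (<-trans (n<1+n m) m<p) ∘ subst (_ ∣_) (*-identityˡ _)

  prime^∣-cancelʳ : ∀ {p m} → Prime p → p ∤ m → ∀ e {n} → p ^ e ∣ n * m → p ^ e ∣ n
  prime^∣-cancelʳ p-prime p∤m zero    _ = 1∣ _
  prime^∣-cancelʳ {p} {m} p-prime p∤m (suc e) {n} p^[1+e]∣nm
    with euclidsLemma n m p-prime (m*n∣⇒m∣ p (p ^ e) p^[1+e]∣nm)
  ... | inj₂ p∣m = contradiction p∣m p∤m
  ... | inj₁ (divides n′ refl) = subst (p ^ suc e ∣_) (*-comm p n′) (*-monoʳ-∣ p p^e∣n′)
    where
    instance _ = prime⇒nonZero p-prime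
    p^e∣n′ : p ^ e ∣ n′
    p^e∣n′ = prime^∣-cancelʳ p-prime p∤m e
               (*-cancelˡ-∣ p (subst (p ^ suc e ∣_) (xy∙z≈y∙xz n′ p m) p^[1+e]∣nm))

  prime^*∣ : ∀ {p m n} e → Prime p → p ∤ m → p ^ e ∣ n → m ∣ n → p ^ e * m ∣ n
  prime^*∣ {m = m} e p-prime p∤m p^e∣n (divides q refl) =
    *-monoˡ-∣ m (prime^∣-cancelʳ p-prime p∤m e {q} p^e∣n)

  primeProd-∣ : ∀ m N {x} → (∀ p → Prime p → p ^ (N ∸ p) ∣ x) → primeProd m N ∣ x
  primeProd-∣ zero    N p^[N-p]∣x = 1∣ _
  primeProd-∣ (suc m) N p^[N-p]∣x with prime? (suc m)
  ... | yes p-prime = prime^*∣ (N ∸ suc m) p-prime (prime∤primeProd N m p-prime ≤-refl)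
                        (p^[N-p]∣x (suc m) p-prime) (primeProd-∣ m N p^[N-p]∣x)
  ... | no  _       = subst (_∣ _) (sym (*-identityˡ _)) (primeProd-∣ m N p^[N-p]∣x)

open import Data.Nat using (ℕ; suc; _+_; _∸_; _^_; _<_; NonZero; >-nonZero⁻¹)
open import Data.Nat.Properties using (≤-refl; ≤-<-trans; m∸n≤m; ∸-monoʳ-<; m∸n+n≡m; +-commutativeSemigroup)
open import Algebra.Properties.CommutativeSemigroup +-commutativeSemigroup using (xy∙z≈xz∙y)
open import Data.Nat.Primality using (Prime; prime⇒nonZero)
open import Data.Integer using (ℤ; +_; _-_)
open import Data.Integer.Divisibility using (_∣_)
open import Data.Integer.Divisibility.Signed using (∣ᵤ⇒∣; ∣⇒∣ᵤ)
open Determinant using (ReducibleRows; reducibleRows⇒∣det)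
open PrimeProduct using (primeProd-∣)

hankel-reducibleRows : ∀ (a : ℕ → ℤ) {d} N .{{_ : NonZero d}} → (∀ k → + d ∣ a (k + d) - a k) →
                       ReducibleRows d d N (hankel a N)
hankel-reducibleRows a {d} N d∣a[k+d]-a[k] r d≤r r<N = g , g<r , λ c →
  ∣ᵤ⇒∣ (subst (λ i → + d ∣ a i - a (toℕ g + toℕ c)) (shift c) (d∣a[k+d]-a[k] (toℕ g + toℕ c)))
  where
  open ≡-Reasoning
  g : Fin N
  g = fromℕ< (≤-<-trans (m∸n≤m (toℕ r) d) r<N)
  toℕg≡r-d : toℕ g ≡ toℕ r ∸ d
  toℕg≡r-d = toℕ-fromℕ< (≤-<-trans (m∸n≤m (toℕ r) d) r<N)
  g<r : toℕ g < toℕ r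
  g<r = subst (_< toℕ r) (sym toℕg≡r-d) (∸-monoʳ-< (>-nonZero⁻¹ d) d≤r)
  shift : ∀ c → toℕ g + toℕ c + d ≡ toℕ r + toℕ c
  shift c = begin
    toℕ g + toℕ c + d      ≡⟨ xy∙z≈xz∙y (toℕ g) (toℕ c) d ⟩
    toℕ g + d + toℕ c      ≡⟨ cong (λ x → x + d + toℕ c) toℕg≡r-d ⟩
    toℕ r ∸ d + d + toℕ c  ≡⟨ cong (_+ toℕ c) (m∸n+n≡m d≤r) ⟩
    toℕ r + toℕ c          ∎

hankel-det-divisible : ∀ (a : ℕ → ℤ) {d} N .{{_ : NonZero d}} → (∀ k → + d ∣ a (k + d) - a k) →
                       + (d ^ (N ∸ d)) ∣ det N (hankel a N)
hankel-det-divisible a {d} N d∣a[k+d]-a[k] =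
  ∣⇒∣ᵤ (reducibleRows⇒∣det d d N (hankel a N) ≤-refl (hankel-reducibleRows a N d∣a[k+d]-a[k]))

lemma3 : (a : ℕ → ℤ) →
         (∀ (n p : ℕ) → Prime p → (+ p) ∣ (a (n + p) - a n)) →
         ∀ (n : ℕ) → (+ primeProd (suc n ∸ 1) (suc n)) ∣ det (suc n) (hankel a (suc n))
lemma3 a congruent n = primeProd-∣ n (suc n) λ p p-prime →
  hankel-det-divisible a (suc n) {{prime⇒nonZero p-prime}} (λ k → congruent k p p-prime)
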